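{- For $k\ge0$ let $\mathcal{L}_k=\sum_{j=0}^k L(k,j)$, where $L(k,j)$ is the Lah number (the number of partitions of $\{1,\dots,k\}$ into $j$ nonempty linearly ordered lists, with $L(0,0)=1$), and define the modified Lah polynomials $\mathcal{P}_n(x)=\sum_{k=0}^n\binom nk\mathcal{L}_kx^{n-k}$. Let $n\ge1$, $s\ge1$, $m\ge0$ be integers and $p\ge3$ a prime. Then $$\mathcal{P}_{n+mp^s}(x)\equiv\left(x^{p^s}+1\right)^m\mathcal{P}_n(x)\pmod p,$$ and in particular $\mathcal{L}_{n+mp^s}\equiv\mathcal{L}_n\pmod p$.
   Context: A congruence $P(x)\equiv Q(x)\pmod p$ between polynomials with integer coefficients means that every coefficient of $P(x)-Q(x)$ is divisible by $p$. The polynomials $\mathcal{P}_n(x)$ have exponential generating function $\sum_n\mathcal{P}_n(x)\frac{t^n}{n!}=\exp\!\left(\frac{t}{1-t}\right)e^{xt}$. -}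

module Defs where

open import Data.Nat as ℕ using (ℕ; zero; suc)
open import Data.Nat.Combinatorics using (_C_)
open import Data.Integer as ℤ using (ℤ; +_)
open import Data.Integer.Divisibility using (_∣_)
open import Relation.Nullary using (yes; no)

-- Lah numbers L(k,j) via the standard recurrence
--   L(0,0) = 1, L(0,j+1) = 0, L(k+1,0) = 0,
--   L(k+1,j+1) = (k+j+1) L(k,j+1) + L(k,j)
-- which counts partitions of {1..k+1} into j+1 nonempty linearly ordered lists.
Lah : ℕ → ℕ → ℕ
Lah zero    zero    = 1
Lah zero    (suc j) = 0
Lah (suc k) zero    = 0
Lah (suc k) (suc j) = (k ℕ.+ suc j) ℕ.* Lah k (suc j) ℕ.+ Lah k j

Σ≤ : ℕ → (ℕ → ℤ) → ℤ
Σ≤ zero    f = f 0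
Σ≤ (suc n) f = Σ≤ n f ℤ.+ f (suc n)

𝓛 : ℕ → ℤ
𝓛 k = Σ≤ k (λ j → + Lah k j)

-- Polynomials with integer coefficients, as coefficient sequences
-- (all polynomials below have finitely many nonzero coefficients).
Poly : Set
Poly = ℕ → ℤ

mono : ℤ → ℕ → Poly
mono c d i with d ℕ.≟ i
... | yes _ = c
... | no  _ = + 0

infixl 6 _⊕_
infixl 7 _⊛_
infixr 8 _^ᴾ_

_⊕_ : Poly → Poly → Poly
(f ⊕ g) i = f i ℤ.+ g i

_⊛_ : Poly → Poly → Poly
(f ⊛ g) i = Σ≤ i (λ j → f j ℤ.* g (i ℕ.∸ j))

one : Poly
one = mono (+ 1) 0

_^ᴾ_ : Poly → ℕ → Poly
f ^ᴾ zero  = one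
f ^ᴾ suc m = f ⊛ (f ^ᴾ m)

𝓟 : ℕ → Poly
𝓟 n = λ i → Σ≤ n (λ k → mono ((+ (n C k)) ℤ.* 𝓛 k) (n ℕ.∸ k) i)

_≡ᴾ_mod_ : Poly → Poly → ℕ → Set
P ≡ᴾ Q mod p = ∀ i → (+ p) ∣ (P i ℤ.- Q i)

{-# OPTIONS --safe #-}
-- The coefficient of x^i in 𝓟 n is C(n,i) 𝓛(n-i), and two periodicities modulo p combine.
-- Frobenius: (1+x)^(n+p^s) ≡ (1+x^(p^s)) (1+x)^n, since p divides C(p^s,i) for 0 < i < p^s.
-- 𝓛 is periodic modulo every q ≥ 1 with period q: L(k+q,j+q) ≡ L(k,j) by the recurrence, and
-- L(k+q,j) ≡ 0 for j < q because q divides L(q,j) = C(q-1,j-1) q!/j!.  Hence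
-- 𝓟(n+p^s) ≡ (x^(p^s)+1) 𝓟 n, and induction on m finishes.  Multiplication by 1 + x^d is
-- taken as shift-and-add, which commutes with ⊛.
module Submission where

open import Defs
open import Data.Nat as ℕ using (ℕ; zero; suc; _+_; _*_; _^_; _∸_; _!; _≤_; _<_; _≥_; z≤n; s≤s; NonZero)
import Data.Nat.Properties as ℕ
open import Data.Nat.Combinatorics using (_C_; nCk+nC[k+1]≡[n+1]C[k+1]; k>n⇒nCk≡0; nC1≡n; nCn≡1; nCk≡nC[n∸k])
open import Data.Nat.Divisibility as ℕ using (_∣0; _∣?_) renaming (_∣_ to _∣ℕ_)
open import Data.Nat.Primality using (Prime; prime⇒nonZero; euclidsLemma)
import Data.Nat.Tactic.RingSolver as ℕ-Solver
open import Data.Integer as ℤ using (ℤ; +_; _-_) renaming (_+_ to _+ℤ_; _*_ to _*ℤ_)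
import Data.Integer.Properties as ℤ
open import Data.Integer.Divisibility using (_∣_)
import Data.Integer.Divisibility.Signed as Signed
import Data.Integer.Tactic.RingSolver as ℤ-Solver
open import Algebra.Properties.CommutativeSemigroup ℤ.+-commutativeSemigroup
  using () renaming (interchange to +ℤ-interchange)
open import Data.Product using (_×_; _,_)
open import Data.Sum using (inj₁; inj₂)
open import Function using (_∘_)
open import Level using (0ℓ)
open import Relation.Nullary using (¬_; yes; no; contradiction)
open import Relation.Binary.Bundles using (Setoid)
open import Relation.Binary.Definitions using (tri<; tri≈; tri>)
open import Relation.Binary.PropositionalEquality
import Relation.Binary.Reasoning.Setoid as SetoidReasoning

infix 4 _≡_mod_

-- A record rather than a synonym, so that a and b can be inferred from a proof.
record _≡_mod_ (a b : ℤ) (p : ℕ) : Set where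
  constructor divides-difference
  field p∣a-b : + p Signed.∣ a - b

open _≡_mod_ public

module _ {p : ℕ} where

  ≡-mod-reflexive : ∀ {a b} → a ≡ b → a ≡ b mod p
  ≡-mod-reflexive {a} refl =
    divides-difference (subst (+ p Signed.∣_) (sym (ℤ.+-inverseʳ a)) (Signed.divides (+ 0) refl))

  ≡-mod-refl : ∀ {a} → a ≡ a mod p
  ≡-mod-refl = ≡-mod-reflexive refl

  ≡-mod-sym : ∀ {a b} → a ≡ b mod p → b ≡ a mod p
  ≡-mod-sym {a} {b} (divides-difference p∣a-b) =
    divides-difference (subst (+ p Signed.∣_) (swap a b) (Signed.∣m⇒∣-m p∣a-b))
    where
    swap : ∀ a b → ℤ.- (a - b) ≡ b - a
    swap = ℤ-Solver.solve-∀

  ≡-mod-trans : ∀ {a b c} → a ≡ b mod p → b ≡ c mod p → a ≡ c mod p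
  ≡-mod-trans {a} {b} {c} (divides-difference p∣a-b) (divides-difference p∣b-c) =
    divides-difference (subst (+ p Signed.∣_) (telescope a b c) (Signed.∣m∣n⇒∣m+n p∣a-b p∣b-c))
    where
    telescope : ∀ a b c → (a - b) +ℤ (b - c) ≡ a - c
    telescope = ℤ-Solver.solve-∀

  +-cong-mod : ∀ {a b c d} → a ≡ b mod p → c ≡ d mod p → a +ℤ c ≡ b +ℤ d mod p
  +-cong-mod {a} {b} {c} {d} (divides-difference p∣a-b) (divides-difference p∣c-d) =
    divides-difference (subst (+ p Signed.∣_) (interchange a b c d) (Signed.∣m∣n⇒∣m+n p∣a-b p∣c-d))
    where
    interchange : ∀ a b c d → (a - b) +ℤ (c - d) ≡ (a +ℤ c) - (b +ℤ d)
    interchange = ℤ-Solver.solve-∀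

  *-cong-mod : ∀ {a b c d} → a ≡ b mod p → c ≡ d mod p → a *ℤ c ≡ b *ℤ d mod p
  *-cong-mod {a} {b} {c} {d} (divides-difference p∣a-b) (divides-difference p∣c-d) =
    divides-difference (subst (+ p Signed.∣_) (split a b c d)
      (Signed.∣m∣n⇒∣m+n (Signed.∣m⇒∣m*n c p∣a-b) (Signed.∣n⇒∣m*n b p∣c-d)))
    where
    split : ∀ a b c d → (a - b) *ℤ c +ℤ b *ℤ (c - d) ≡ a *ℤ c - b *ℤ d
    split = ℤ-Solver.solve-∀

  ∣⇒≡0-mod : ∀ {a} → + p Signed.∣ a → a ≡ + 0 mod p
  ∣⇒≡0-mod {a} p∣a = divides-difference (subst (+ p Signed.∣_) (sym (ℤ.+-identityʳ a)) p∣a)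

  ≡+m*p⇒≡-mod : ∀ {a b} m → a ≡ b + m * p → + a ≡ + b mod p
  ≡+m*p⇒≡-mod {b = b} m refl =
    divides-difference (subst (+ p Signed.∣_) difference (Signed.∣n⇒∣m*n (+ m) Signed.∣-refl))
    where
    cancel : ∀ x y → y ≡ (x +ℤ y) - x
    cancel = ℤ-Solver.solve-∀
    difference : + m *ℤ + p ≡ + (b + m * p) - + b
    difference = trans (cancel (+ b) (+ m *ℤ + p))
      (cong (_- + b) (sym (trans (ℤ.pos-+ b (m * p)) (cong (+ b +ℤ_) (ℤ.pos-* m p)))))

  ≡-mod-∣ : ∀ {d a b} → d ∣ℕ p → a ≡ b mod p → a ≡ b mod d
  ≡-mod-∣ d∣p (divides-difference p∣a-b) = divides-difference (Signed.∣-trans (Signed.∣ᵤ⇒∣ d∣p) p∣a-b)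

≡-mod-setoid : ℕ → Setoid 0ℓ 0ℓ
≡-mod-setoid p = record
  { Carrier       = ℤ
  ; _≈_           = λ a b → a ≡ b mod p
  ; isEquivalence = record { refl = ≡-mod-refl ; sym = ≡-mod-sym ; trans = ≡-mod-trans }
  }

module ≡-mod-Reasoning (p : ℕ) = SetoidReasoning (≡-mod-setoid p)

Σ≤-cong : ∀ n {f g : ℕ → ℤ} → f ≗ g → Σ≤ n f ≡ Σ≤ n g
Σ≤-cong zero    f≗g = f≗g 0
Σ≤-cong (suc n) f≗g = cong₂ _+ℤ_ (Σ≤-cong n f≗g) (f≗g (suc n))

Σ≤-cong-mod : ∀ {p} n {f g : ℕ → ℤ} → (∀ j → f j ≡ g j mod p) → Σ≤ n f ≡ Σ≤ n g mod p
Σ≤-cong-mod zero    f≡g = f≡g 0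
Σ≤-cong-mod (suc n) f≡g = +-cong-mod (Σ≤-cong-mod n f≡g) (f≡g (suc n))

Σ≤-+ : ∀ n (f g : ℕ → ℤ) → Σ≤ n (λ j → f j +ℤ g j) ≡ Σ≤ n f +ℤ Σ≤ n g
Σ≤-+ zero    f g = refl
Σ≤-+ (suc n) f g = trans (cong (_+ℤ (f (suc n) +ℤ g (suc n))) (Σ≤-+ n f g))
  (+ℤ-interchange (Σ≤ n f) (Σ≤ n g) (f (suc n)) (g (suc n)))

Σ≤-suc : ∀ n (f : ℕ → ℤ) → Σ≤ (suc n) f ≡ f 0 +ℤ Σ≤ n (f ∘ suc)
Σ≤-suc zero    f = refl
Σ≤-suc (suc n) f = trans (cong (_+ℤ f (suc (suc n))) (Σ≤-suc n f)) (ℤ.+-assoc (f 0) _ _)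

Σ≤-zero : ∀ n {f : ℕ → ℤ} → (∀ {j} → j ≤ n → f j ≡ + 0) → Σ≤ n f ≡ + 0
Σ≤-zero zero    f≡0 = f≡0 z≤n
Σ≤-zero (suc n) f≡0 = cong₂ _+ℤ_ (Σ≤-zero n (f≡0 ∘ ℕ.m≤n⇒m≤1+n)) (f≡0 ℕ.≤-refl)

Σ≤-single : ∀ n {d} (f : ℕ → ℤ) → d ≤ n → (∀ {j} → j ≤ n → j ≢ d → f j ≡ + 0) → Σ≤ n f ≡ f d
Σ≤-single zero    f z≤n    _   = refl
Σ≤-single (suc n) f d≤1+n off with ℕ.m≤n⇒m<n∨m≡n d≤1+n
... | inj₁ (s≤s d≤n) = trans (cong₂ _+ℤ_ (Σ≤-single n f d≤n (off ∘ ℕ.m≤n⇒m≤1+n))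
                                           (off ℕ.≤-refl (ℕ.>⇒≢ (s≤s d≤n))))
                              (ℤ.+-identityʳ _)
... | inj₂ refl      = trans (cong (_+ℤ f (suc n)) (Σ≤-zero n below)) (ℤ.+-identityˡ _)
  where
  below : ∀ {j} → j ≤ n → f j ≡ + 0
  below j≤n = off (ℕ.m≤n⇒m≤1+n j≤n) (ℕ.<⇒≢ (s≤s j≤n))

Σ≤-drop-mod : ∀ {p} a n (f : ℕ → ℤ) → (∀ {j} → j < a → f j ≡ + 0 mod p) →
              Σ≤ (a + n) f ≡ Σ≤ n (λ j → f (a + j)) mod p
Σ≤-drop-mod zero    n f _   = ≡-mod-refl
Σ≤-drop-mod {p} (suc a) n f low = begin
  Σ≤ (suc (a + n)) f
    ≡⟨ Σ≤-suc (a + n) f ⟩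
  f 0 +ℤ Σ≤ (a + n) (f ∘ suc)
    ≈⟨ +-cong-mod (low (s≤s z≤n)) (Σ≤-drop-mod a n (f ∘ suc) (low ∘ s≤s)) ⟩
  + 0 +ℤ Σ≤ n (λ j → f (suc a + j))
    ≡⟨ ℤ.+-identityˡ _ ⟩
  Σ≤ n (λ j → f (suc a + j))
    ∎
  where open ≡-mod-Reasoning p

-- Polynomials as coefficient sequences

infixr 8 x^_·_ 1+x^_·_

x^_·_ : ℕ → Poly → Poly
(x^ zero  · f) i       = f i
(x^ suc d · f) zero    = + 0
(x^ suc d · f) (suc i) = (x^ d · f) i

1+x^_·_ : ℕ → Poly → Poly
1+x^ d · f = x^ d · f ⊕ f

x^·-≥ : ∀ d f {i} → d ≤ i → (x^ d · f) i ≡ f (i ∸ d)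
x^·-≥ zero    f _         = refl
x^·-≥ (suc d) f (s≤s d≤i) = x^·-≥ d f d≤i

x^·-< : ∀ d f {i} → i < d → (x^ d · f) i ≡ + 0
x^·-< (suc d) f {zero}  _         = refl
x^·-< (suc d) f {suc i} (s≤s i<d) = x^·-< d f i<d

x^·-cong-mod : ∀ {p} d {f g : Poly} → (∀ i → f i ≡ g i mod p) →
               ∀ i → (x^ d · f) i ≡ (x^ d · g) i mod p
x^·-cong-mod zero    f≡g i       = f≡g i
x^·-cong-mod (suc d) f≡g zero    = ≡-mod-refl
x^·-cong-mod (suc d) f≡g (suc i) = x^·-cong-mod d f≡g i

x^·-⊕ : ∀ d f g → x^ d · (f ⊕ g) ≗ x^ d · f ⊕ x^ d · g
x^·-⊕ zero    f g i       = refl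
x^·-⊕ (suc d) f g zero    = refl
x^·-⊕ (suc d) f g (suc i) = x^·-⊕ d f g i

x^·-x^· : ∀ a b f → x^ a · x^ b · f ≗ x^ (a + b) · f
x^·-x^· zero    b f i       = refl
x^·-x^· (suc a) b f zero    = refl
x^·-x^· (suc a) b f (suc i) = x^·-x^· a b f i

x^·-comm : ∀ a b f → x^ a · x^ b · f ≗ x^ b · x^ a · f
x^·-comm a b f i = begin
  (x^ a · x^ b · f) i  ≡⟨ x^·-x^· a b f i ⟩
  (x^ (a + b) · f) i   ≡⟨ cong (λ e → (x^ e · f) i) (ℕ.+-comm a b) ⟩
  (x^ (b + a) · f) i   ≡⟨ x^·-x^· b a f i ⟨
  (x^ b · x^ a · f) i  ∎
  where open ≡-Reasoning

1+x^·-comm : ∀ a b f → 1+x^ a · 1+x^ b · f ≗ 1+x^ b · 1+x^ a · f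
1+x^·-comm a b f i = begin
  (x^ a · (x^ b · f ⊕ f)) i +ℤ ((x^ b · f) i +ℤ f i)
    ≡⟨ cong (_+ℤ ((x^ b · f) i +ℤ f i)) (x^·-⊕ a (x^ b · f) f i) ⟩
  ((x^ a · x^ b · f) i +ℤ (x^ a · f) i) +ℤ ((x^ b · f) i +ℤ f i)
    ≡⟨ +ℤ-interchange ((x^ a · x^ b · f) i) ((x^ a · f) i) ((x^ b · f) i) (f i) ⟩
  ((x^ a · x^ b · f) i +ℤ (x^ b · f) i) +ℤ ((x^ a · f) i +ℤ f i)
    ≡⟨ cong (λ e → (e +ℤ (x^ b · f) i) +ℤ ((x^ a · f) i +ℤ f i)) (x^·-comm a b f i) ⟩
  ((x^ b · x^ a · f) i +ℤ (x^ b · f) i) +ℤ ((x^ a · f) i +ℤ f i)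
    ≡⟨ cong (_+ℤ ((x^ a · f) i +ℤ f i)) (x^·-⊕ b (x^ a · f) f i) ⟨
  (x^ b · (x^ a · f ⊕ f)) i +ℤ ((x^ a · f) i +ℤ f i)
    ∎
  where open ≡-Reasoning

1+x^·-cong-mod : ∀ {p} d {f g : Poly} → (∀ i → f i ≡ g i mod p) →
                 ∀ i → (1+x^ d · f) i ≡ (1+x^ d · g) i mod p
1+x^·-cong-mod d f≡g i = +-cong-mod (x^·-cong-mod d f≡g i) (f≡g i)

mono-on : ∀ c {d i} → d ≡ i → mono c d i ≡ c
mono-on c {d} {i} d≡i with d ℕ.≟ i
... | yes _   = refl
... | no d≢i = contradiction d≡i d≢i

mono-off : ∀ c {d i} → i ≢ d → mono c d i ≡ + 0
mono-off c {d} {i} i≢d with d ℕ.≟ i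
... | yes d≡i = contradiction (sym d≡i) i≢d
... | no _    = refl

⊛-congˡ : ∀ {f g} h → f ≗ g → f ⊛ h ≗ g ⊛ h
⊛-congˡ h f≗g i = Σ≤-cong i (λ j → cong (_*ℤ h (i ∸ j)) (f≗g j))

⊛-distribʳ-⊕ : ∀ f g h → (f ⊕ g) ⊛ h ≗ f ⊛ h ⊕ g ⊛ h
⊛-distribʳ-⊕ f g h i = trans (Σ≤-cong i (λ j → ℤ.*-distribʳ-+ (h (i ∸ j)) (f j) (g j))) (Σ≤-+ i _ _)

x^·-⊛ : ∀ d f g → (x^ d · f) ⊛ g ≗ x^ d · (f ⊛ g)
x^·-⊛ zero    f g i       = refl
x^·-⊛ (suc d) f g zero    = refl
x^·-⊛ (suc d) f g (suc i) = trans (Σ≤-suc i _) (trans (ℤ.+-identityˡ _) (x^·-⊛ d f g i))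

1+x^·-⊛ : ∀ d f g → (1+x^ d · f) ⊛ g ≗ 1+x^ d · (f ⊛ g)
1+x^·-⊛ d f g i = trans (⊛-distribʳ-⊕ (x^ d · f) f g i) (cong (_+ℤ (f ⊛ g) i) (x^·-⊛ d f g i))

mono-⊛ : ∀ d f → mono (+ 1) d ⊛ f ≗ x^ d · f
mono-⊛ d f i with d ℕ.≤? i
... | yes d≤i = begin
  Σ≤ i (λ j → mono (+ 1) d j *ℤ f (i ∸ j))
    ≡⟨ Σ≤-single i _ d≤i (λ {j} _ j≢d → cong (_*ℤ f (i ∸ j)) (mono-off (+ 1) j≢d)) ⟩
  mono (+ 1) d d *ℤ f (i ∸ d)
    ≡⟨ cong (_*ℤ f (i ∸ d)) (mono-on (+ 1) {d} refl) ⟩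
  + 1 *ℤ f (i ∸ d)
    ≡⟨ ℤ.*-identityˡ (f (i ∸ d)) ⟩
  f (i ∸ d)
    ≡⟨ x^·-≥ d f d≤i ⟨
  (x^ d · f) i
    ∎
  where open ≡-Reasoning
... | no d≰i = trans (Σ≤-zero i off) (sym (x^·-< d f (ℕ.≰⇒> d≰i)))
  where
  off : ∀ {j} → j ≤ i → mono (+ 1) d j *ℤ f (i ∸ j) ≡ + 0
  off {j} j≤i = cong (_*ℤ f (i ∸ j)) (mono-off (+ 1) {d} (λ { refl → d≰i j≤i }))

⊛-identityˡ : ∀ f → one ⊛ f ≗ f
⊛-identityˡ = mono-⊛ 0

x^+1-⊛ : ∀ d f → (mono (+ 1) d ⊕ one) ⊛ f ≗ 1+x^ d · f
x^+1-⊛ d f i = trans (⊛-distribʳ-⊕ (mono (+ 1) d) one f i) (cong₂ _+ℤ_ (mono-⊛ d f i) (⊛-identityˡ f i))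

-- Binomial coefficients

binom : ℕ → Poly
binom n k = + (n C k)

binom-suc : ∀ n → binom (suc n) ≗ 1+x^ 1 · binom n
binom-suc n zero    = refl
binom-suc n (suc k) = cong +_ (sym (nCk+nC[k+1]≡[n+1]C[k+1] n k))

[k+1]*[n+1]C[k+1]≡[n+1]*nCk : ∀ n k → suc k * (suc n C suc k) ≡ suc n * (n C k)
[k+1]*[n+1]C[k+1]≡[n+1]*nCk zero    zero    = refl
[k+1]*[n+1]C[k+1]≡[n+1]*nCk zero    (suc k) = ℕ.*-zeroʳ (suc (suc k))
[k+1]*[n+1]C[k+1]≡[n+1]*nCk (suc n) zero    =
  trans (ℕ.*-identityˡ _) (trans (nC1≡n (suc (suc n))) (sym (ℕ.*-identityʳ (suc (suc n)))))
[k+1]*[n+1]C[k+1]≡[n+1]*nCk (suc n) (suc k) = begin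
  suc (suc k) * (suc (suc n) C suc (suc k))
    ≡⟨ cong (suc (suc k) *_) (nCk+nC[k+1]≡[n+1]C[k+1] (suc n) (suc k)) ⟨
  suc (suc k) * (a + b)
    ≡⟨ expand (suc k) a b ⟩
  suc k * a + suc (suc k) * b + a
    ≡⟨ cong₂ (λ u v → u + v + a) ([k+1]*[n+1]C[k+1]≡[n+1]*nCk n k) ([k+1]*[n+1]C[k+1]≡[n+1]*nCk n (suc k)) ⟩
  suc n * (n C k) + suc n * (n C suc k) + a
    ≡⟨ cong (_+ a) (ℕ.*-distribˡ-+ (suc n) (n C k) (n C suc k)) ⟨
  suc n * (n C k + n C suc k) + a
    ≡⟨ cong (λ u → suc n * u + a) (nCk+nC[k+1]≡[n+1]C[k+1] n k) ⟩
  suc n * a + a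
    ≡⟨ ℕ.+-comm (suc n * a) a ⟩
  suc (suc n) * a
    ∎
  where
  open ≡-Reasoning
  a = suc n C suc k
  b = suc n C suc (suc k)
  expand : ∀ k a b → suc k * (a + b) ≡ k * a + suc k * b + a
  expand = ℕ-Solver.solve-∀

n∣k*nCk : ∀ n k → n ∣ℕ k * (n C k)
n∣k*nCk zero    zero    = 0 ∣0
n∣k*nCk zero    (suc k) = ℕ.∣-reflexive (sym (ℕ.*-zeroʳ (suc k)))
n∣k*nCk (suc n) zero    = suc n ∣0
n∣k*nCk (suc n) (suc k) = subst (suc n ∣ℕ_) (sym ([k+1]*[n+1]C[k+1]≡[n+1]*nCk n k)) (ℕ.m∣m*n (n C k))

-- Lah numbers

j>k⇒Lah[k,j]≡0 : ∀ {k j} → k < j → Lah k j ≡ 0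
j>k⇒Lah[k,j]≡0 {zero}  {suc j} _         = refl
j>k⇒Lah[k,j]≡0 {suc k} {suc j} (s≤s k<j) = cong₂ _+_
  (trans (cong ((k + suc j) *_) (j>k⇒Lah[k,j]≡0 (ℕ.m<n⇒m<1+n k<j))) (ℕ.*-zeroʳ (k + suc j)))
  (j>k⇒Lah[k,j]≡0 k<j)

Lah[k,k]≡1 : ∀ k → Lah k k ≡ 1
Lah[k,k]≡1 zero    = refl
Lah[k,k]≡1 (suc k) = cong₂ _+_
  (trans (cong ((k + suc k) *_) (j>k⇒Lah[k,j]≡0 (ℕ.n<1+n k))) (ℕ.*-zeroʳ (k + suc k)))
  (Lah[k,k]≡1 k)

k*Lah[k,0]≡0 : ∀ k → k * Lah k 0 ≡ 0
k*Lah[k,0]≡0 zero    = refl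
k*Lah[k,0]≡0 (suc k) = ℕ.*-zeroʳ (suc k)

Lah[k+1,1]≡[k+1]! : ∀ k → Lah (suc k) 1 ≡ suc k !
Lah[k+1,1]≡[k+1]! zero    = refl
Lah[k+1,1]≡[k+1]! (suc k) =
  trans (ℕ.+-identityʳ _) (cong₂ _*_ (ℕ.+-comm (suc k) 1) (Lah[k+1,1]≡[k+1]! k))

[j+1]!*Lah[k+1,j+1]≡[k+1]!*kCj : ∀ k j → suc j ! * Lah (suc k) (suc j) ≡ suc k ! * (k C j)
[j+1]!*Lah[k+1,j+1]≡[k+1]!*kCj k zero =
  trans (ℕ.*-identityˡ _) (trans (Lah[k+1,1]≡[k+1]! k) (sym (ℕ.*-identityʳ (suc k !))))
[j+1]!*Lah[k+1,j+1]≡[k+1]!*kCj zero (suc j) =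
  trans (cong (suc (suc j) ! *_) (j>k⇒Lah[k,j]≡0 {1} {suc (suc j)} (s≤s (s≤s z≤n)))) (ℕ.*-zeroʳ (suc (suc j) !))
[j+1]!*Lah[k+1,j+1]≡[k+1]!*kCj (suc k) (suc j) = begin
  suc (suc j) ! * ((suc k + suc (suc j)) * Lah (suc k) (suc (suc j)) + Lah (suc k) (suc j))
    ≡⟨ distribute (suc k) (suc j) (suc j !) (Lah (suc k) (suc (suc j))) (Lah (suc k) (suc j)) ⟩
  (suc k + suc (suc j)) * (suc (suc j) ! * Lah (suc k) (suc (suc j))) + suc (suc j) * (suc j ! * Lah (suc k) (suc j))
    ≡⟨ cong₂ (λ u v → (suc k + suc (suc j)) * u + suc (suc j) * v)
             ([j+1]!*Lah[k+1,j+1]≡[k+1]!*kCj k (suc j)) ([j+1]!*Lah[k+1,j+1]≡[k+1]!*kCj k j) ⟩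
  (suc k + suc (suc j)) * (suc k ! * X) + suc (suc j) * (suc k ! * Y)
    ≡⟨ collect (suc k) (suc j) (suc k !) X Y ⟩
  suc k ! * (suc (suc k) * X + (suc j * (Y + X) + Y))
    ≡⟨ cong (λ u → suc k ! * (suc (suc k) * X + (u + Y))) absorb ⟩
  suc k ! * (suc (suc k) * X + (suc k * Y + Y))
    ≡⟨ factor (suc k) (suc k !) X Y ⟩
  suc (suc k) ! * (Y + X)
    ≡⟨ cong (suc (suc k) ! *_) (nCk+nC[k+1]≡[n+1]C[k+1] k j) ⟩
  suc (suc k) ! * (suc k C suc j)
    ∎
  where
  open ≡-Reasoning
  X = k C suc j
  Y = k C j
  absorb : suc j * (Y + X) ≡ suc k * Y
  absorb = trans (cong (suc j *_) (nCk+nC[k+1]≡[n+1]C[k+1] k j)) ([k+1]*[n+1]C[k+1]≡[n+1]*nCk k j)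
  distribute : ∀ k j a l₁ l₀ →
    suc j * a * ((k + suc j) * l₁ + l₀) ≡ (k + suc j) * (suc j * a * l₁) + suc j * (a * l₀)
  distribute = ℕ-Solver.solve-∀
  collect : ∀ k j f x y → (k + suc j) * (f * x) + suc j * (f * y) ≡ f * (suc k * x + (j * (y + x) + y))
  collect = ℕ-Solver.solve-∀
  factor : ∀ k f x y → f * (suc k * x + (k * y + y)) ≡ suc k * f * (y + x)
  factor = ℕ-Solver.solve-∀

n∣Lah[n,j] : ∀ {n j} → j < n → n ∣ℕ Lah n j
n∣Lah[n,j] {suc k} {zero}  _         = suc k ∣0
n∣Lah[n,j] {suc k} {suc j} (s≤s j<k) =
  ℕ.*-cancelˡ-∣ (suc j !) {{suc j ℕ.!≢0}}
    (subst (suc j ! * suc k ∣ℕ_) (sym ([j+1]!*Lah[k+1,j+1]≡[k+1]!*kCj k j)) [j+1]!*[k+1]∣[k+1]!*kCj)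
  where
  [j+1]!*[k+1]∣[k+1]!*kCj : suc j ! * suc k ∣ℕ suc k ! * (k C j)
  [j+1]!*[k+1]∣[k+1]!*kCj = ℕ.∣m⇒∣m*n (k C j)
    (subst (suc j ! * suc k ∣ℕ_) (ℕ.*-comm (k !) (suc k)) (ℕ.*-pres-∣ (ℕ.m≤n⇒m!∣n! j<k) ℕ.∣-refl))

n∣Lah[k+n,j] : ∀ k {n j} → j < n → n ∣ℕ Lah (k + n) j
n∣Lah[k+n,j] zero            j<n = n∣Lah[n,j] j<n
n∣Lah[k+n,j] (suc k) {n} {zero}  _   = n ∣0
n∣Lah[k+n,j] (suc k) {n} {suc j} j<n = ℕ.∣m∣n⇒∣m+n
  (ℕ.∣n⇒∣m*n (k + n + suc j) (n∣Lah[k+n,j] k j<n))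
  (n∣Lah[k+n,j] k (ℕ.<⇒≤ j<n))

pos-*-+ : ∀ a b c → + (a * b + c) ≡ + a *ℤ + b +ℤ + c
pos-*-+ a b c = trans (ℤ.pos-+ (a * b) c) (cong (_+ℤ + c) (ℤ.pos-* a b))

Lah[k+n,j+n]≡Lah[k,j] : ∀ {n} .{{_ : NonZero n}} k j → + Lah (k + n) (j + n) ≡ + Lah k j mod n
Lah[k+n,j+n]≡Lah[k,j] {n} zero zero    = ≡-mod-reflexive (cong +_ (Lah[k,k]≡1 n))
Lah[k+n,j+n]≡Lah[k,j] {n} zero (suc j) = ≡-mod-reflexive (cong +_ (j>k⇒Lah[k,j]≡0 (ℕ.m<n+m n (s≤s z≤n))))
Lah[k+n,j+n]≡Lah[k,j] {n@(suc m)} (suc k) zero = begin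
  + Lah (suc k + n) n
    ≡⟨ pos-*-+ (k + n + n) (Lah (k + n) n) (Lah (k + n) m) ⟩
  + (k + n + n) *ℤ + Lah (k + n) n +ℤ + Lah (k + n) m
    ≈⟨ +-cong-mod (*-cong-mod (≡+m*p⇒≡-mod {b = k} 2 (twice k n)) (Lah[k+n,j+n]≡Lah[k,j] k zero))
                  (∣⇒≡0-mod (Signed.∣ᵤ⇒∣ (n∣Lah[k+n,j] k (ℕ.n<1+n m)))) ⟩
  + k *ℤ + Lah k 0 +ℤ + 0
    ≡⟨ pos-*-+ k (Lah k 0) 0 ⟨
  + (k * Lah k 0 + 0)
    ≡⟨ cong (λ x → + (x + 0)) (k*Lah[k,0]≡0 k) ⟩
  + 0
    ∎
  where
  open ≡-mod-Reasoning n
  twice : ∀ k n → k + n + n ≡ k + 2 * n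
  twice = ℕ-Solver.solve-∀
Lah[k+n,j+n]≡Lah[k,j] {n} (suc k) (suc j) = begin
  + Lah (suc k + n) (suc j + n)
    ≡⟨ pos-*-+ (k + n + suc (j + n)) (Lah (k + n) (suc j + n)) (Lah (k + n) (j + n)) ⟩
  + (k + n + suc (j + n)) *ℤ + Lah (k + n) (suc j + n) +ℤ + Lah (k + n) (j + n)
    ≈⟨ +-cong-mod (*-cong-mod (≡+m*p⇒≡-mod {b = k + suc j} 2 (twice k j n))
                              (Lah[k+n,j+n]≡Lah[k,j] k (suc j)))
                  (Lah[k+n,j+n]≡Lah[k,j] k j) ⟩
  + (k + suc j) *ℤ + Lah k (suc j) +ℤ + Lah k j
    ≡⟨ pos-*-+ (k + suc j) (Lah k (suc j)) (Lah k j) ⟨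
  + Lah (suc k) (suc j)
    ∎
  where
  open ≡-mod-Reasoning n
  twice : ∀ k j n → k + n + suc (j + n) ≡ k + suc j + 2 * n
  twice = ℕ-Solver.solve-∀

𝓛[k+n]≡𝓛[k] : ∀ {n} .{{_ : NonZero n}} k → 𝓛 (k + n) ≡ 𝓛 k mod n
𝓛[k+n]≡𝓛[k] {n} k = begin
  Σ≤ (k + n) (λ j → + Lah (k + n) j)
    ≡⟨ cong (λ b → Σ≤ b (λ j → + Lah (k + n) j)) (ℕ.+-comm k n) ⟩
  Σ≤ (n + k) (λ j → + Lah (k + n) j)
    ≈⟨ Σ≤-drop-mod n k _ (λ j<n → ∣⇒≡0-mod (Signed.∣ᵤ⇒∣ (n∣Lah[k+n,j] k j<n))) ⟩
  Σ≤ k (λ j → + Lah (k + n) (n + j))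
    ≡⟨ Σ≤-cong k (λ j → cong (λ i → + Lah (k + n) i) (ℕ.+-comm n j)) ⟩
  Σ≤ k (λ j → + Lah (k + n) (j + n))
    ≈⟨ Σ≤-cong-mod k (Lah[k+n,j+n]≡Lah[k,j] k) ⟩
  Σ≤ k (λ j → + Lah k j)
    ∎
  where open ≡-mod-Reasoning n

𝓛-periodic : ∀ {n} .{{_ : NonZero n}} m k → 𝓛 (k + m * n) ≡ 𝓛 k mod n
𝓛-periodic     zero    k = ≡-mod-reflexive (cong 𝓛 (ℕ.+-identityʳ k))
𝓛-periodic {n} (suc m) k = begin
  𝓛 (k + (n + m * n))   ≡⟨ cong (λ x → 𝓛 (k + x)) (ℕ.+-comm n (m * n)) ⟩
  𝓛 (k + (m * n + n))   ≡⟨ cong 𝓛 (ℕ.+-assoc k (m * n) n) ⟨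
  𝓛 (k + m * n + n)     ≈⟨ 𝓛[k+n]≡𝓛[k] (k + m * n) ⟩
  𝓛 (k + m * n)         ≈⟨ 𝓛-periodic m k ⟩
  𝓛 k                   ∎
  where open ≡-mod-Reasoning n

-- The polynomials 𝓟

𝓟-coeff : ∀ n → 𝓟 n ≗ λ i → binom n i *ℤ 𝓛 (n ∸ i)
𝓟-coeff n i with i ℕ.≤? n
... | yes i≤n = begin
  Σ≤ n (λ k → mono (+ (n C k) *ℤ 𝓛 k) (n ∸ k) i)
    ≡⟨ Σ≤-single n _ (ℕ.m∸n≤m n i) off ⟩
  mono (+ (n C (n ∸ i)) *ℤ 𝓛 (n ∸ i)) (n ∸ (n ∸ i)) i
    ≡⟨ mono-on _ (ℕ.m∸[m∸n]≡n i≤n) ⟩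
  + (n C (n ∸ i)) *ℤ 𝓛 (n ∸ i)
    ≡⟨ cong (λ c → + c *ℤ 𝓛 (n ∸ i)) (nCk≡nC[n∸k] i≤n) ⟨
  binom n i *ℤ 𝓛 (n ∸ i)
    ∎
  where
  open ≡-Reasoning
  off : ∀ {k} → k ≤ n → k ≢ n ∸ i → mono (+ (n C k) *ℤ 𝓛 k) (n ∸ k) i ≡ + 0
  off {k} k≤n k≢n∸i = mono-off (+ (n C k) *ℤ 𝓛 k) {n ∸ k} (λ i≡n∸k → k≢n∸i (trans (sym (ℕ.m∸[m∸n]≡n k≤n)) (cong (n ∸_) (sym i≡n∸k))))
... | no i≰n = trans
  (Σ≤-zero n (λ {k} _ → mono-off _ (λ i≡n∸k → i≰n (subst (_≤ n) (sym i≡n∸k) (ℕ.m∸n≤m n k)))))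
  (cong (λ c → + c *ℤ 𝓛 (n ∸ i)) (sym (k>n⇒nCk≡0 (ℕ.≰⇒> i≰n))))

x^·binom*𝓛≡x^·𝓟 : ∀ d n i → (x^ d · binom n) i *ℤ 𝓛 (n + d ∸ i) ≡ (x^ d · 𝓟 n) i
x^·binom*𝓛≡x^·𝓟 d n i with d ℕ.≤? i
... | yes d≤i = begin
  (x^ d · binom n) i *ℤ 𝓛 (n + d ∸ i)  ≡⟨ cong₂ _*ℤ_ (x^·-≥ d (binom n) d≤i) (cong 𝓛 index) ⟩
  binom n (i ∸ d) *ℤ 𝓛 (n ∸ (i ∸ d))   ≡⟨ 𝓟-coeff n (i ∸ d) ⟨
  𝓟 n (i ∸ d)                         ≡⟨ x^·-≥ d (𝓟 n) d≤i ⟨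
  (x^ d · 𝓟 n) i                      ∎
  where
  open ≡-Reasoning
  index : n + d ∸ i ≡ n ∸ (i ∸ d)
  index = trans (cong₂ _∸_ (ℕ.+-comm n d) (sym (ℕ.m+[n∸m]≡n d≤i))) (ℕ.[m+n]∸[m+o]≡n∸o d n (i ∸ d))
... | no d≰i = trans (cong (_*ℤ 𝓛 (n + d ∸ i)) (x^·-< d (binom n) (ℕ.≰⇒> d≰i)))
                     (sym (x^·-< d (𝓟 n) (ℕ.≰⇒> d≰i)))

binom*𝓛≡𝓟-mod : ∀ {q N} .{{_ : NonZero N}} → q ∣ℕ N →
                 ∀ n i → binom n i *ℤ 𝓛 (n + N ∸ i) ≡ 𝓟 n i mod q
binom*𝓛≡𝓟-mod {q} {N} q∣N n i with i ℕ.≤? n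
... | yes i≤n = begin
  binom n i *ℤ 𝓛 (n + N ∸ i)
    ≡⟨ cong (λ k → binom n i *ℤ 𝓛 k) (ℕ.+-∸-comm N i≤n) ⟩
  binom n i *ℤ 𝓛 (n ∸ i + N)
    ≈⟨ *-cong-mod (≡-mod-refl {a = binom n i}) (≡-mod-∣ q∣N (𝓛[k+n]≡𝓛[k] {N} (n ∸ i))) ⟩
  binom n i *ℤ 𝓛 (n ∸ i)
    ≡⟨ 𝓟-coeff n i ⟨
  𝓟 n i
    ∎
  where open ≡-mod-Reasoning q
... | no i≰n = ≡-mod-reflexive (trans (vanish (n + N ∸ i)) (sym (trans (𝓟-coeff n i) (vanish (n ∸ i)))))
  where
  vanish : ∀ k → binom n i *ℤ 𝓛 k ≡ + 0
  vanish k = cong (λ c → + c *ℤ 𝓛 k) (k>n⇒nCk≡0 (ℕ.≰⇒> i≰n))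

-- Congruences modulo a prime

module _ {p : ℕ} (p-prime : Prime p) where

  private instance
    p≢0 : NonZero p
    p≢0 = prime⇒nonZero p-prime

  p^s∣m*n⇒p^s∣m : ∀ s {m n} → ¬ p ∣ℕ n → p ^ s ∣ℕ m * n → p ^ s ∣ℕ m
  p^s∣m*n⇒p^s∣m zero    _   _ = ℕ.1∣ _
  p^s∣m*n⇒p^s∣m (suc s) {m} {n} p∤n p^[1+s]∣mn
    with euclidsLemma m n p-prime (ℕ.∣-trans (ℕ.m∣m*n (p ^ s)) p^[1+s]∣mn)
  ... | inj₂ p∣n = contradiction p∣n p∤n
  ... | inj₁ (ℕ.divides c refl) =
    subst (p ^ suc s ∣ℕ_) (ℕ.*-comm p c)
      (ℕ.*-monoʳ-∣ p (p^s∣m*n⇒p^s∣m s p∤n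
        (ℕ.*-cancelˡ-∣ p (subst (p ^ suc s ∣ℕ_) (regroup c p n) p^[1+s]∣mn))))
    where
    regroup : ∀ c p n → c * p * n ≡ p * (c * n)
    regroup = ℕ-Solver.solve-∀

  p∣[p^s]Ci : ∀ s {i} → 0 < i → i < p ^ s → p ∣ℕ p ^ s C i
  p∣[p^s]Ci s {i} 0<i i<p^s with p ∣? p ^ s C i
  ... | yes p∣C = p∣C
  ... | no  p∤C = contradiction
    (ℕ.∣⇒≤ {{ℕ.>-nonZero 0<i}} (p^s∣m*n⇒p^s∣m s p∤C (n∣k*nCk (p ^ s) i)))
    (ℕ.<⇒≱ i<p^s)

  binom-frobenius-base : ∀ s i → binom (p ^ s) i ≡ (1+x^ p ^ s · binom 0) i mod p
  binom-frobenius-base s zero =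
    ≡-mod-reflexive (sym (cong (_+ℤ + 1) (x^·-< (p ^ s) (binom 0) (ℕ.m^n>0 p s))))
  binom-frobenius-base s (suc i) with ℕ.<-cmp (suc i) (p ^ s)
  ... | tri< i<p^s _ _ = ≡-mod-trans
    (∣⇒≡0-mod (Signed.∣ᵤ⇒∣ (p∣[p^s]Ci s (s≤s z≤n) i<p^s)))
    (≡-mod-reflexive (sym (cong (_+ℤ + 0) (x^·-< (p ^ s) (binom 0) i<p^s))))
  ... | tri≈ _ i≡p^s _ = ≡-mod-reflexive (begin
    binom (p ^ s) (suc i)                ≡⟨ cong (binom (p ^ s)) i≡p^s ⟩
    binom (p ^ s) (p ^ s)                ≡⟨ cong +_ (nCn≡1 (p ^ s)) ⟩
    + 1                                  ≡⟨ cong (binom 0) (ℕ.n∸n≡0 (p ^ s)) ⟨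
    binom 0 (p ^ s ∸ p ^ s)              ≡⟨ cong (λ k → binom 0 (k ∸ p ^ s)) i≡p^s ⟨
    binom 0 (suc i ∸ p ^ s)              ≡⟨ x^·-≥ (p ^ s) (binom 0) (ℕ.≤-reflexive (sym i≡p^s)) ⟨
    (x^ p ^ s · binom 0) (suc i)         ≡⟨ ℤ.+-identityʳ _ ⟨
    (1+x^ p ^ s · binom 0) (suc i)       ∎)
    where open ≡-Reasoning
  ... | tri> _ _ i>p^s = ≡-mod-reflexive (begin
    binom (p ^ s) (suc i)                ≡⟨ cong +_ (k>n⇒nCk≡0 i>p^s) ⟩
    + 0                                  ≡⟨ cong +_ (k>n⇒nCk≡0 (ℕ.m<n⇒0<n∸m i>p^s)) ⟨
    binom 0 (suc i ∸ p ^ s)              ≡⟨ x^·-≥ (p ^ s) (binom 0) (ℕ.<⇒≤ i>p^s) ⟨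
    (x^ p ^ s · binom 0) (suc i)         ≡⟨ ℤ.+-identityʳ _ ⟨
    (1+x^ p ^ s · binom 0) (suc i)       ∎)
    where open ≡-Reasoning

  binom-frobenius : ∀ s n i → binom (n + p ^ s) i ≡ (1+x^ p ^ s · binom n) i mod p
  binom-frobenius s zero    i = binom-frobenius-base s i
  binom-frobenius s (suc n) i = begin
    binom (suc n + p ^ s) i              ≡⟨ binom-suc (n + p ^ s) i ⟩
    (1+x^ 1 · binom (n + p ^ s)) i       ≈⟨ 1+x^·-cong-mod 1 (binom-frobenius s n) i ⟩
    (1+x^ 1 · 1+x^ p ^ s · binom n) i    ≡⟨ 1+x^·-comm 1 (p ^ s) (binom n) i ⟩
    (1+x^ p ^ s · 1+x^ 1 · binom n) i    ≈⟨ 1+x^·-cong-mod (p ^ s) (≡-mod-reflexive ∘ sym ∘ binom-suc n) i ⟩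
    (1+x^ p ^ s · binom (suc n)) i       ∎
    where open ≡-mod-Reasoning p

  p∣p^s : ∀ s .{{_ : NonZero s}} → p ∣ℕ p ^ s
  p∣p^s (suc s) = ℕ.m∣m*n (p ^ s)

  𝓟[n+p^s]≡[1+x^p^s]·𝓟[n] : ∀ s .{{_ : NonZero s}} n i →
    𝓟 (n + p ^ s) i ≡ (1+x^ p ^ s · 𝓟 n) i mod p
  𝓟[n+p^s]≡[1+x^p^s]·𝓟[n] s n i = begin
    𝓟 (n + p ^ s) i
      ≡⟨ 𝓟-coeff (n + p ^ s) i ⟩
    binom (n + p ^ s) i *ℤ 𝓛 (n + p ^ s ∸ i)
      ≈⟨ *-cong-mod (binom-frobenius s n i) ≡-mod-refl ⟩
    (1+x^ p ^ s · binom n) i *ℤ 𝓛 (n + p ^ s ∸ i)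
      ≡⟨ ℤ.*-distribʳ-+ (𝓛 (n + p ^ s ∸ i)) ((x^ p ^ s · binom n) i) (binom n i) ⟩
    (x^ p ^ s · binom n) i *ℤ 𝓛 (n + p ^ s ∸ i) +ℤ binom n i *ℤ 𝓛 (n + p ^ s ∸ i)
      ≈⟨ +-cong-mod (≡-mod-reflexive (x^·binom*𝓛≡x^·𝓟 (p ^ s) n i))
                    (binom*𝓛≡𝓟-mod {{ℕ.m^n≢0 p s}} (p∣p^s s) n i) ⟩
    (1+x^ p ^ s · 𝓟 n) i
      ∎
    where open ≡-mod-Reasoning p

  𝓟[n+m*p^s]≡[x^p^s+1]^m⊛𝓟[n] : ∀ s .{{_ : NonZero s}} m n i →
    𝓟 (n + m * p ^ s) i ≡ ((mono (+ 1) (p ^ s) ⊕ one) ^ᴾ m ⊛ 𝓟 n) i mod p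
  𝓟[n+m*p^s]≡[x^p^s+1]^m⊛𝓟[n] s zero n i =
    ≡-mod-reflexive (trans (cong (λ k → 𝓟 k i) (ℕ.+-identityʳ n)) (sym (⊛-identityˡ (𝓟 n) i)))
  𝓟[n+m*p^s]≡[x^p^s+1]^m⊛𝓟[n] s (suc m) n i = begin
    𝓟 (n + (p ^ s + m * p ^ s)) i
      ≡⟨ cong (λ k → 𝓟 (n + k) i) (ℕ.+-comm (p ^ s) (m * p ^ s)) ⟩
    𝓟 (n + (m * p ^ s + p ^ s)) i
      ≡⟨ cong (λ k → 𝓟 k i) (ℕ.+-assoc n (m * p ^ s) (p ^ s)) ⟨
    𝓟 (n + m * p ^ s + p ^ s) i
      ≈⟨ 𝓟[n+p^s]≡[1+x^p^s]·𝓟[n] s (n + m * p ^ s) i ⟩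
    (1+x^ p ^ s · 𝓟 (n + m * p ^ s)) i
      ≈⟨ 1+x^·-cong-mod (p ^ s) (𝓟[n+m*p^s]≡[x^p^s+1]^m⊛𝓟[n] s m n) i ⟩
    (1+x^ p ^ s · (g ^ᴾ m ⊛ 𝓟 n)) i
      ≡⟨ 1+x^·-⊛ (p ^ s) (g ^ᴾ m) (𝓟 n) i ⟨
    ((1+x^ p ^ s · g ^ᴾ m) ⊛ 𝓟 n) i
      ≡⟨ ⊛-congˡ (𝓟 n) (x^+1-⊛ (p ^ s) (g ^ᴾ m)) i ⟨
    (g ^ᴾ suc m ⊛ 𝓟 n) i
      ∎
    where
    open ≡-mod-Reasoning p
    g = mono (+ 1) (p ^ s) ⊕ one

  𝓛[n+m*p^s]≡𝓛[n] : ∀ s .{{_ : NonZero s}} m n → 𝓛 (n + m * p ^ s) ≡ 𝓛 n mod p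
  𝓛[n+m*p^s]≡𝓛[n] s m n = ≡-mod-∣ (p∣p^s s) (𝓛-periodic {{ℕ.m^n≢0 p s}} m n)

corollary6 : (n s m p : ℕ) → n ≥ 1 → s ≥ 1 → Prime p → p ≥ 3 →
    ((𝓟 (n + m * p ^ s)) ≡ᴾ ((mono (+ 1) (p ^ s) ⊕ mono (+ 1) 0) ^ᴾ m ⊛ 𝓟 n) mod p)
    × ((+ p) ∣ (𝓛 (n + m * p ^ s) - 𝓛 n))
corollary6 n s m p _ s≥1 p-prime _ =
  (λ i → Signed.∣⇒∣ᵤ (p∣a-b (𝓟[n+m*p^s]≡[x^p^s+1]^m⊛𝓟[n] p-prime s m n i))) ,
  Signed.∣⇒∣ᵤ (p∣a-b (𝓛[n+m*p^s]≡𝓛[n] p-prime s m n))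
  where instance _ = ℕ.>-nonZero s≥1
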